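{- Let $\Theta$ be a variety of algebras and $H\in\Theta$. The contravariant functor $\varphi:\Theta^0\to\Theta^*(H)$, given on objects by $W(X)\mapsto \mathrm{Hom}(W(X),H)$ and on morphisms by $s\mapsto\tilde s$, defines a duality of categories if and only if $\mathrm{Var}(H)=\Theta$ (i.e. $H$ generates the variety $\Theta$).
   Context: Fix an infinite set of variables $X^0$ and let $\Gamma$ be the set of finite subsets of $X^0$. For $X\in\Gamma$, $W(X)$ denotes the free algebra of $\Theta$ over $X$. $\Theta^0$ is the category whose objects are the algebras $W(X)$, $X\in\Gamma$, and whose morphisms are homomorphisms between them. $\Theta^*(H)$ is the category whose objects are the sets $\mathrm{Hom}(W(X),H)$, $X\in\Gamma$, and whose morphisms $\mathrm{Hom}(W(X),H)\to\mathrm{Hom}(W(Y),H)$ are exactly the maps $\tilde s$ induced by homomorphisms $s:W(Y)\to W(X)$ via $\tilde s(\nu)=\nu\circ s$. $\mathrm{Var}(H)$ is the variety generated by $H$. -}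

module Defs where

open import Level using (0ℓ)
open import Data.Nat using (ℕ)
open import Data.Fin using (Fin)
open import Data.List using (List)
open import Data.List.Membership.Propositional using (_∈_)
open import Data.Product using (Σ; ∃; _×_; _,_; proj₁; proj₂)
open import Relation.Binary using (Setoid; IsEquivalence)
open import Function using (_∘_; id; _⇔_)

record Signature : Set₁ where
  field
    Op    : Set
    arity : Op → ℕ

record Algebra (S : Signature) : Set₁ where
  open Signature S
  field
    setoid : Setoid 0ℓ 0ℓ
  open Setoid setoid public
  field
    ⟦_⟧     : (f : Op) → (Fin (arity f) → Carrier) → Carrier
    ⟦⟧-cong : ∀ f {xs ys : Fin (arity f) → Carrier} →
              (∀ i → xs i ≈ ys i) → ⟦ f ⟧ xs ≈ ⟦ f ⟧ ys

module _ {S : Signature} where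
  open Signature S

  data Term (V : Set) : Set where
    var : V → Term V
    op  : (f : Op) → (Fin (arity f) → Term V) → Term V

  sub : {V U : Set} → (V → Term U) → Term V → Term U
  sub σ (var x)   = σ x
  sub σ (op f ts) = op f (λ i → sub σ (ts i))

  eval : (A : Algebra S) {V : Set} → (V → Algebra.Carrier A) → Term V → Algebra.Carrier A
  eval A ρ (var x)   = ρ x
  eval A ρ (op f ts) = Algebra.⟦_⟧ A f (λ i → eval A ρ (ts i))

-- Identities are written in the variables X⁰ = ℕ
Identity : Signature → Set
Identity S = Term {S} ℕ × Term {S} ℕ

_⊨_ : {S : Signature} → Algebra S → Identity S → Set
A ⊨ (l , r) = ∀ (ρ : ℕ → Algebra.Carrier A) → Algebra._≈_ A (eval A ρ l) (eval A ρ r)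

record Variety : Set₁ where
  field
    sig : Signature
    ids : Identity sig → Set

open Variety public

_∈V_ : {Θ : Variety} → Algebra (sig Θ) → Variety → Set
_∈V_ {Θ} A _ = ∀ e → ids Θ e → A ⊨ e

-- A belongs to Var(H): it satisfies every identity of H
-- (Var(H) = the smallest equational class containing H)
_∈Var_ : {S : Signature} → Algebra S → Algebra S → Set
A ∈Var H = ∀ e → H ⊨ e → A ⊨ e

VarEq : (Θ : Variety) → Algebra (sig Θ) → Set₁
VarEq Θ H = ∀ (A : Algebra (sig Θ)) → (A ∈Var H) ⇔ (_∈V_ {Θ} A Θ)

record Hom {S : Signature} (A B : Algebra S) : Set where
  open Signature S
  private
    module A = Algebra A
    module B = Algebra B
  field
    map     : A.Carrier → B.Carrier
    map-cong : ∀ {x y} → x A.≈ y → map x B.≈ map y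
    map-op  : ∀ f (xs : Fin (arity f) → A.Carrier) →
              map (A.⟦ f ⟧ xs) B.≈ B.⟦ f ⟧ (map ∘ xs)
open Hom public

_≐_ : {S : Signature} {A B : Algebra S} → Hom A B → Hom A B → Set
_≐_ {B = B} g h = ∀ x → Algebra._≈_ B (map g x) (map h x)

idHom : {S : Signature} {A : Algebra S} → Hom A A
idHom {A = A} = record
  { map = id ; map-cong = id ; map-op = λ f xs → Algebra.refl A }

_∘H_ : {S : Signature} {A B C : Algebra S} → Hom B C → Hom A B → Hom A C
_∘H_ {A = A} {B} {C} g h = record
  { map = map g ∘ map h
  ; map-cong = map-cong g ∘ map-cong h
  ; map-op = λ f xs → Algebra.trans C (map-cong g (map-op h f xs)) (map-op g f (map h ∘ xs))
  }

-- Free algebra W(X) of a variety Θ over a finite set X ⊆ X⁰ = ℕ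
-- (X ∈ Γ represented by a list of variables): terms over X modulo the
-- congruence generated by all substitution instances of the identities of Θ.

Vars : List ℕ → Set
Vars X = Σ ℕ (λ x → x ∈ X)

module _ (Θ : Variety) where
  open Signature (sig Θ)

  data _⊢_≋_ (V : Set) : Term {sig Θ} V → Term V → Set where
    ax    : ∀ {l r} → ids Θ (l , r) → (σ : ℕ → Term V) → V ⊢ sub σ l ≋ sub σ r
    rfl   : ∀ {t} → V ⊢ t ≋ t
    sym≋  : ∀ {t u} → V ⊢ t ≋ u → V ⊢ u ≋ t
    trans≋ : ∀ {t u v} → V ⊢ t ≋ u → V ⊢ u ≋ v → V ⊢ t ≋ v
    cong≋ : ∀ f {ts us} → (∀ i → V ⊢ ts i ≋ us i) → V ⊢ op f ts ≋ op f us

  W : List ℕ → Algebra (sig Θ)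
  W X = record
    { setoid = record
      { Carrier = Term (Vars X)
      ; _≈_ = Vars X ⊢_≋_
      ; isEquivalence = record { refl = rfl ; sym = sym≋ ; trans = trans≋ } }
    ; ⟦_⟧ = op
    ; ⟦⟧-cong = cong≋ }

record Category : Set₁ where
  field
    Obj  : Set
    _⇒_  : Obj → Obj → Set
    _≈_  : ∀ {A B} → A ⇒ B → A ⇒ B → Set
    idC  : ∀ {A} → A ⇒ A
    _∘C_ : ∀ {A B C} → B ⇒ C → A ⇒ B → A ⇒ C

record ContraFunctor (C D : Category) : Set where
  private
    module C = Category C
    module D = Category D
  field
    F₀ : C.Obj → D.Obj
    F₁ : ∀ {A B} → A C.⇒ B → F₀ B D.⇒ F₀ A

module _ {C D : Category} (φ : ContraFunctor C D) where
  private
    module C = Category C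
    module D = Category D
  open ContraFunctor φ

  Full : Set
  Full = ∀ {A B} (g : F₀ B D.⇒ F₀ A) → ∃ λ (f : A C.⇒ B) → F₁ f D.≈ g

  Faithful : Set
  Faithful = ∀ {A B} (f g : A C.⇒ B) → F₁ f D.≈ F₁ g → f C.≈ g

  EssSurj : Set
  EssSurj = ∀ (d : D.Obj) → ∃ λ (c : C.Obj) →
            Σ (F₀ c D.⇒ d) λ u → Σ (d D.⇒ F₀ c) λ v →
            ((u D.∘C v) D.≈ D.idC) × ((v D.∘C u) D.≈ D.idC)

  IsDuality : Set
  IsDuality = Full × Faithful × EssSurj

module _ (Θ : Variety) (H : Algebra (sig Θ)) where

  Θ⁰ : Category
  Θ⁰ = record
    { Obj = List ℕ
    ; _⇒_ = λ X Y → Hom (W Θ X) (W Θ Y)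
    ; _≈_ = _≐_
    ; idC = idHom
    ; _∘C_ = _∘H_ }

  tilde : ∀ {X Y} → Hom (W Θ Y) (W Θ X) → Hom (W Θ X) H → Hom (W Θ Y) H
  tilde s ν = ν ∘H s

  _⇒*_ : List ℕ → List ℕ → Set
  X ⇒* Y = Σ (Hom (W Θ X) H → Hom (W Θ Y) H) λ F →
           ∃ λ (s : Hom (W Θ Y) (W Θ X)) → ∀ ν → F ν ≐ tilde s ν

  Θ* : Category
  Θ* = record
    { Obj = List ℕ
    ; _⇒_ = _⇒*_
    ; _≈_ = λ F G → ∀ ν → proj₁ F ν ≐ proj₁ G ν
    ; idC = (λ ν → ν) , idHom , (λ ν x → Algebra.refl H)
    ; _∘C_ = λ { (G , t , pG) (F , s , pF) →
        (G ∘ F) , (s ∘H t) , (λ ν x → Algebra.trans H (pG (F ν) x) (pF ν (map t x))) } }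

  φ : ContraFunctor Θ⁰ Θ*
  φ = record
    { F₀ = λ X → X
    ; F₁ = λ s → tilde s , s , (λ ν x → Algebra.refl H) }

-- The functor φ is always full and essentially surjective: Θ*(H) has the same
-- objects as Θ⁰ and its morphisms are by definition the maps s̃. So φ is a
-- duality iff it is faithful, i.e. iff homomorphisms W(X) → H separate the
-- points of every W(X). This holds iff every identity of H holds in every free
-- algebra W(X): an identity u ≈ v over X valid in H, renamed into X⁰, is
-- valid in W(X), and instantiating its variables by the generators gives
-- u = v in W(X). Finally this is Var(H) = Θ: an identity of H holds in W(X)
-- for a finite X containing its variables, so it is derivable from the
-- identities of Θ and therefore holds in every algebra of Θ.
module Submission where

open import Defs
open import Data.List using ([]; _∷_; upTo; tabulate)
open import Data.List.Extrema.Nat using (max; xs≤max)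
open import Data.List.Membership.Propositional.Properties using (∈-upTo⁺)
open import Data.List.Relation.Unary.All.Properties using (tabulate⁻)
open import Data.List.Relation.Unary.Any using (here; there)
open import Data.Maybe using (Maybe; just; nothing; maybe′)
import Data.Maybe as Maybe
open import Data.Nat using (ℕ; zero; suc; _≤_; s≤s; _⊓_; _⊔_)
open import Data.Nat.Properties using (≤-refl; ≤-trans; m⊓n≤n; m≤n⇒m⊓n≡m; m≤m⊔n; m≤n⊔m)
open import Data.Product using (_,_; proj₁)
open import Function using (_∘_; _⇔_; mk⇔; Equivalence)
open import Function.Construct.Composition using (_⇔-∘_)
open import Relation.Binary.PropositionalEquality as ≡ using (_≡_)
import Relation.Binary.Reasoning.Setoid as SetoidReasoning

private variable
  V U : Set

module _ {S : Signature} where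

  rename : (V → U) → Term {S} V → Term U
  rename f = sub (var ∘ f)

  Satisfies : Algebra S → Term {S} V → Term V → Set
  Satisfies A u v = ∀ ρ → Algebra._≈_ A (eval A ρ u) (eval A ρ v)

  module _ (A : Algebra S) where
    open Algebra A
    open SetoidReasoning setoid

    eval-cong : ∀ {ρ₁ ρ₂ : V → Carrier} t → (∀ x → ρ₁ x ≈ ρ₂ x) → eval A ρ₁ t ≈ eval A ρ₂ t
    eval-cong (var x)   ρ₁≈ρ₂ = ρ₁≈ρ₂ x
    eval-cong (op f ts) ρ₁≈ρ₂ = ⟦⟧-cong f (λ i → eval-cong (ts i) ρ₁≈ρ₂)

    eval-sub : ∀ (ρ : U → Carrier) (σ : V → Term U) t → eval A ρ (sub σ t) ≈ eval A (eval A ρ ∘ σ) t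
    eval-sub ρ σ (var x)   = refl
    eval-sub ρ σ (op f ts) = ⟦⟧-cong f (λ i → eval-sub ρ σ (ts i))

    satisfies-rename : ∀ (f : V → U) {u v} → Satisfies A u v → Satisfies A (rename f u) (rename f v)
    satisfies-rename f {u} {v} A⊨u≈v ρ = begin
      eval A ρ (rename f u) ≈⟨ eval-sub ρ (var ∘ f) u ⟩
      eval A (ρ ∘ f) u      ≈⟨ A⊨u≈v (ρ ∘ f) ⟩
      eval A (ρ ∘ f) v      ≈⟨ eval-sub ρ (var ∘ f) v ⟨
      eval A ρ (rename f v) ∎

    satisfies-unrename : ∀ (f : V → U) (g : U → Maybe V) → (∀ x → g (f x) ≡ just x) →
                         ∀ {u v} → Satisfies A (rename f u) (rename f v) → Satisfies A u v
    satisfies-unrename {U = U} f g g∘f≡just {u} {v} A⊨fu≈fv ρ = begin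
      eval A ρ u             ≈⟨ eval-cong u ρ′∘f≈ρ ⟨
      eval A (ρ′ ∘ f) u      ≈⟨ eval-sub ρ′ (var ∘ f) u ⟨
      eval A ρ′ (rename f u) ≈⟨ A⊨fu≈fv ρ′ ⟩
      eval A ρ′ (rename f v) ≈⟨ eval-sub ρ′ (var ∘ f) v ⟩
      eval A (ρ′ ∘ f) v      ≈⟨ eval-cong v ρ′∘f≈ρ ⟩
      eval A ρ v             ∎
      where
      -- Off the image of f the value of ρ′ is irrelevant; eval A ρ u merely
      -- avoids assuming that A is inhabited.
      ρ′ : U → Carrier
      ρ′ = maybe′ ρ (eval A ρ u) ∘ g

      ρ′∘f≈ρ : ∀ x → ρ′ (f x) ≈ ρ x
      ρ′∘f≈ρ x = reflexive (≡.cong (maybe′ ρ (eval A ρ u)) (g∘f≡just x))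

  hom-eval : ∀ {A B : Algebra S} (ν : Hom A B) (ρ : V → Algebra.Carrier A) t →
             Algebra._≈_ B (map ν (eval A ρ t)) (eval B (map ν ∘ ρ) t)
  hom-eval {B = B} ν ρ (var x)   = Algebra.refl B
  hom-eval {B = B} ν ρ (op f ts) =
    Algebra.trans B (map-op ν f _) (Algebra.⟦⟧-cong B f (λ i → hom-eval ν ρ (ts i)))

  bound : Term {S} ℕ → ℕ
  bound (var n)   = n
  bound (op f ts) = max 0 (tabulate (λ i → bound (ts i)))

  bound-arg : ∀ f ts i → bound (ts i) ≤ bound (op f ts)
  bound-arg f ts = tabulate⁻ (xs≤max 0 (tabulate (λ i → bound (ts i))))

  eval-agree : ∀ (A : Algebra S) t {ρ₁ ρ₂ : ℕ → Algebra.Carrier A} →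
               (∀ n → n ≤ bound t → Algebra._≈_ A (ρ₁ n) (ρ₂ n)) →
               Algebra._≈_ A (eval A ρ₁ t) (eval A ρ₂ t)
  eval-agree A (var n)   ρ₁≈ρ₂ = ρ₁≈ρ₂ n ≤-refl
  eval-agree A (op f ts) ρ₁≈ρ₂ = Algebra.⟦⟧-cong A f λ i →
    eval-agree A (ts i) (λ n n≤ → ρ₁≈ρ₂ n (≤-trans n≤ (bound-arg f ts i)))

-- Variables are numbered by position: a variable of Vars X carries its
-- membership proof, so proj₁ is not injective when X has repetitions.
encode : ∀ X → Vars X → ℕ
encode (_ ∷ X) (_ , here _)    = zero
encode (_ ∷ X) (n , there n∈X) = suc (encode X (n , n∈X))

Vars-there : ∀ {x X} → Vars X → Vars (x ∷ X)
Vars-there (n , n∈X) = n , there n∈X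

decode : ∀ X → ℕ → Maybe (Vars X)
decode []      _       = nothing
decode (x ∷ X) zero    = just (x , here ≡.refl)
decode (x ∷ X) (suc k) = Maybe.map Vars-there (decode X k)

decode-encode : ∀ X w → decode X (encode X w) ≡ just w
decode-encode (_ ∷ X) (_ , here ≡.refl) = ≡.refl
decode-encode (_ ∷ X) (n , there n∈X)  = ≡.cong (Maybe.map Vars-there) (decode-encode X (n , n∈X))

clamp : ∀ N → ℕ → Vars (upTo (suc N))
clamp N n = n ⊓ N , ∈-upTo⁺ (s≤s (m⊓n≤n n N))

clamp-≤ : ∀ {N n} → n ≤ N → proj₁ (clamp N n) ≡ n
clamp-≤ = m≤n⇒m⊓n≡m

IsModel : (Θ : Variety) → Algebra (sig Θ) → Set
IsModel Θ A = _∈V_ {Θ} A Θ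

FreeAlgebrasInVar : (Θ : Variety) → Algebra (sig Θ) → Set
FreeAlgebrasInVar Θ H = ∀ X → W Θ X ∈Var H

module _ {Θ : Variety} where

  module _ (A : Algebra (sig Θ)) (A∈Θ : IsModel Θ A) where
    open Algebra A
    open SetoidReasoning setoid

    sound : ∀ {u v} → _⊢_≋_ Θ V u v → Satisfies A u v
    sound (ax {l} {r} l≈r∈Θ σ) ρ = begin
      eval A ρ (sub σ l)      ≈⟨ eval-sub A ρ σ l ⟩
      eval A (eval A ρ ∘ σ) l ≈⟨ A∈Θ (l , r) l≈r∈Θ (eval A ρ ∘ σ) ⟩
      eval A (eval A ρ ∘ σ) r ≈⟨ eval-sub A ρ σ r ⟨
      eval A ρ (sub σ r)      ∎
    sound rfl            ρ = refl
    sound (sym≋ d)       ρ = sym (sound d ρ)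
    sound (trans≋ d e)   ρ = trans (sound d ρ) (sound e ρ)
    sound (cong≋ f ds)   ρ = ⟦⟧-cong f (λ i → sound (ds i) ρ)

    extend : ∀ {X} → (Vars X → Carrier) → Hom (W Θ X) A
    extend ρ = record
      { map      = eval A ρ
      ; map-cong = λ u≋v → sound u≋v ρ
      ; map-op   = λ f xs → refl
      }

  eval-W : ∀ {X} (σ : V → Term (Vars X)) t → _⊢_≋_ Θ (Vars X) (eval (W Θ X) σ t) (sub σ t)
  eval-W σ (var x)   = rfl
  eval-W σ (op f ts) = cong≋ f (λ i → eval-W σ (ts i))

  eval-W-var : ∀ {X} (t : Term (Vars X)) → _⊢_≋_ Θ (Vars X) (eval (W Θ X) var t) t
  eval-W-var (var x)   = rfl
  eval-W-var (op f ts) = cong≋ f (λ i → eval-W-var (ts i))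

  W-satisfies⇒≋ : ∀ {X} {u v : Term (Vars X)} → Satisfies (W Θ X) u v → _⊢_≋_ Θ (Vars X) u v
  W-satisfies⇒≋ {u = u} {v} W⊨u≈v =
    trans≋ (sym≋ (eval-W-var u)) (trans≋ (W⊨u≈v var) (eval-W-var v))

  W-isModel : ∀ X → IsModel Θ (W Θ X)
  W-isModel X (l , r) l≈r∈Θ σ = trans≋ (eval-W σ l) (trans≋ (ax l≈r∈Θ σ) (sym≋ (eval-W σ r)))

module _ (Θ : Variety) (H : Algebra (sig Θ)) where
  open Algebra H using (_≈_)

  ∈Var⇒isModel : IsModel Θ H → ∀ {A} → A ∈Var H → IsModel Θ A
  ∈Var⇒isModel H∈Θ A∈VarH e e∈Θ = A∈VarH e (H∈Θ e e∈Θ)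

  freeAlgebrasInVar⇒∈Var : FreeAlgebrasInVar Θ H → ∀ {A} → IsModel Θ A → A ∈Var H
  freeAlgebrasInVar⇒∈Var free {A} A∈Θ (l , r) H⊨l≈r ρ = begin
    eval A ρ l                     ≈⟨ unclamp l (m≤m⊔n _ _) ⟨
    eval A (ρ ∘ proj₁ ∘ clamp N) l ≈⟨ hom-eval ρ̂ σ l ⟨
    map ρ̂ (eval (W Θ X) σ l)       ≈⟨ map-cong ρ̂ (free X (l , r) H⊨l≈r σ) ⟩
    map ρ̂ (eval (W Θ X) σ r)       ≈⟨ hom-eval ρ̂ σ r ⟩
    eval A (ρ ∘ proj₁ ∘ clamp N) r ≈⟨ unclamp r (m≤n⊔m _ _) ⟩
    eval A ρ r                     ∎
    where
    open SetoidReasoning (Algebra.setoid A)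
    N = bound l ⊔ bound r
    X = upTo (suc N)

    σ : ℕ → Term (Vars X)
    σ = var ∘ clamp N

    ρ̂ : Hom (W Θ X) A
    ρ̂ = extend A A∈Θ (ρ ∘ proj₁)

    unclamp : ∀ t → bound t ≤ N → Algebra._≈_ A (eval A (ρ ∘ proj₁ ∘ clamp N) t) (eval A ρ t)
    unclamp t t≤N = eval-agree A t (λ n n≤t → Algebra.reflexive A (≡.cong ρ (clamp-≤ (≤-trans n≤t t≤N))))

  φ-full : Full (φ Θ H)
  φ-full (_ , s , F≐s̃) = s , λ ν x → Algebra.sym H (F≐s̃ ν x)

  φ-essSurj : EssSurj (φ Θ H)
  φ-essSurj X = X , idC , idC , (λ _ _ → Algebra.refl H) , (λ _ _ → Algebra.refl H)
    where open Category (Θ* Θ H)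

  isDuality⇔faithful : IsDuality (φ Θ H) ⇔ Faithful (φ Θ H)
  isDuality⇔faithful = mk⇔ (λ (_ , faithful , _) → faithful) faithful⇒isDuality
    where
    faithful⇒isDuality : Faithful (φ Θ H) → IsDuality (φ Θ H)
    faithful⇒isDuality faithful = φ-full , faithful , φ-essSurj

  faithful⇒separating : Faithful (φ Θ H) → ∀ {X} {a b : Term (Vars X)} →
                        (∀ (ν : Hom (W Θ X) H) → map ν a ≈ map ν b) → _⊢_≋_ Θ (Vars X) a b
  faithful⇒separating faithful {X} {a} {b} νa≈νb = faithful (point a) (point b) νs≈νt (var (0 , here ≡.refl))
    where
    open SetoidReasoning (Algebra.setoid H)

    point : Term (Vars X) → Hom (W Θ (0 ∷ [])) (W Θ X)
    point c = extend (W Θ X) (W-isModel X) (λ _ → c)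

    νs≈νt : ∀ ν x → map ν (map (point a) x) ≈ map ν (map (point b) x)
    νs≈νt ν x = begin
      map ν (map (point a) x)   ≈⟨ hom-eval ν (λ _ → a) x ⟩
      eval H (λ _ → map ν a) x  ≈⟨ eval-cong H x (λ _ → νa≈νb ν) ⟩
      eval H (λ _ → map ν b) x  ≈⟨ hom-eval ν (λ _ → b) x ⟨
      map ν (map (point b) x)   ∎

  faithful⇒freeAlgebrasInVar : Faithful (φ Θ H) → FreeAlgebrasInVar Θ H
  faithful⇒freeAlgebrasInVar faithful X (l , r) H⊨l≈r σ = faithful⇒separating faithful λ ν → begin
    map ν (eval (W Θ X) σ l) ≈⟨ hom-eval ν σ l ⟩
    eval H (map ν ∘ σ) l     ≈⟨ H⊨l≈r (map ν ∘ σ) ⟩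
    eval H (map ν ∘ σ) r     ≈⟨ hom-eval ν σ r ⟨
    map ν (eval (W Θ X) σ r) ∎
    where open SetoidReasoning (Algebra.setoid H)

  freeAlgebrasInVar⇒faithful : IsModel Θ H → FreeAlgebrasInVar Θ H → Faithful (φ Θ H)
  freeAlgebrasInVar⇒faithful H∈Θ free {B = X} s t s̃≈t̃ x =
    W-satisfies⇒≋ {Θ = Θ} (satisfies-unrename (W Θ X) (encode X) (decode X) (decode-encode X) {u} {v}
                            (free X (rename (encode X) u , rename (encode X) v)
                                    (satisfies-rename H (encode X) {u} {v} H⊨u≈v)))
    where
    u v : Term (Vars X)
    u = map s x
    v = map t x

    H⊨u≈v : Satisfies H u v
    H⊨u≈v ρ = s̃≈t̃ (extend H H∈Θ ρ) x

  faithful⇔freeAlgebrasInVar : IsModel Θ H → Faithful (φ Θ H) ⇔ FreeAlgebrasInVar Θ H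
  faithful⇔freeAlgebrasInVar H∈Θ =
    mk⇔ faithful⇒freeAlgebrasInVar (freeAlgebrasInVar⇒faithful H∈Θ)

  freeAlgebrasInVar⇔varEq : IsModel Θ H → FreeAlgebrasInVar Θ H ⇔ VarEq Θ H
  freeAlgebrasInVar⇔varEq H∈Θ = mk⇔
    (λ free A → mk⇔ (∈Var⇒isModel H∈Θ {A}) (freeAlgebrasInVar⇒∈Var free {A}))
    (λ varEq X → Equivalence.from (varEq (W Θ X)) (W-isModel X))

proposition2p2 : (Θ : Variety) (H : Algebra (sig Θ)) → _∈V_ {Θ} H Θ →
    IsDuality (φ Θ H) ⇔ VarEq Θ H
proposition2p2 Θ H H∈Θ =
  freeAlgebrasInVar⇔varEq Θ H H∈Θ ⇔-∘ (faithful⇔freeAlgebrasInVar Θ H H∈Θ ⇔-∘ isDuality⇔faithful Θ H)
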